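{- Let $G$ be a finite abstract simplicial complex and $x\in G$. Then $w_m(U(x))=\chi(U(x))^m$ for all $m\ge 1$.
   Context: A finite abstract simplicial complex $G$ is a finite set of non-empty finite sets closed under taking non-empty subsets. For $y\in G$, $\omega(y)=(-1)^{|y|-1}$, and for $A\subset G$, $\chi(A)=\sum_{y\in A}\omega(y)$. The star of $x$ is $U(x)=\{y\in G: x\subset y\}$. For $A\subset G$ and $m\ge1$, the $m$-th characteristic is $w_m(A)=\sum \prod_{j=1}^m\omega(x_j)$, the sum over all $m$-tuples $(x_1,\dots,x_m)\in A^m$ with $\bigcap_{j=1}^m x_j\in A$ (in particular non-empty). -}

module Defs where

open import Data.Nat using (ℕ; zero; suc)
open import Data.Bool using (Bool)
import Data.Bool.Properties as BoolP
open import Data.Integer using (ℤ; +_; -_; _+_; _*_; _^_)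
open import Data.List using (List; []; _∷_; map; concatMap; filter; foldr)
open import Data.List.Relation.Unary.Any using (Any; any?)
open import Data.List.Relation.Unary.Unique.Propositional using (Unique)
open import Data.List.Membership.Propositional using (_∈_)
open import Data.Fin.Subset using (Subset; _⊆_; ⋂; Nonempty; ∣_∣)
open import Data.Fin.Subset.Properties using (_⊆?_)
open import Data.Vec.Properties using (≡-dec)
open import Data.Product using (_×_)
open import Relation.Binary.PropositionalEquality using (_≡_)
open import Relation.Nullary using (Dec; yes; no)

record Complex (n : ℕ) : Set where
  field
    faces    : List (Subset n)
    unique   : Unique faces
    nonempty : ∀ {y} → y ∈ faces → Nonempty y
    closed   : ∀ {x y} → y ∈ faces → Nonempty x → x ⊆ y → x ∈ faces
open Complex public

sumℤ : List ℤ → ℤ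
sumℤ = foldr _+_ (+ 0)

productℤ : List ℤ → ℤ
productℤ = foldr _*_ (+ 1)

ω : ∀ {n} → Subset n → ℤ
ω y = signPow ∣ y ∣
  where
  signPow : ℕ → ℤ
  signPow zero = - (+ 1)     -- unused for non-empty simplices
  signPow (suc k) = (- (+ 1)) ^ k

χ : ∀ {n} → List (Subset n) → ℤ
χ A = sumℤ (map ω A)

U : ∀ {n} → Complex n → Subset n → List (Subset n)
U G x = filter (λ y → x ⊆? y) (faces G)

tuples : ∀ {A : Set} → ℕ → List A → List (List A)
tuples zero    A = [] ∷ []
tuples (suc m) A = concatMap (λ a → map (a ∷_) (tuples m A)) A

_∈?_ : ∀ {n} (s : Subset n) (A : List (Subset n)) → Dec (Any (s ≡_) A)
s ∈? A = any? (λ t → ≡-dec BoolP._≟_ s t) A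

contrib : ∀ {n} → List (Subset n) → List (Subset n) → ℤ
contrib A xs with ⋂ xs ∈? A
... | yes _ = productℤ (map ω xs)
... | no  _ = + 0

w : ∀ {n} → ℕ → List (Subset n) → ℤ
w m A = sumℤ (map (contrib A) (tuples m A))

-- The star U(x) is closed under pairwise intersection: if x ⊆ a and x ⊆ b
-- then x ⊆ a ∩ b, and a ∩ b is a non-empty face of a. Hence every tuple
-- drawn from U(x) has its intersection in U(x), the constraint in w_m is
-- vacuous, and w_m(U(x)) is the full sum over U(x)^m of Π ω(x_j), which
-- factors as (Σ_{y ∈ U(x)} ω(y))^m = χ(U(x))^m.
module Submission where

open import Defs
open import Data.Nat using (ℕ; zero; suc)
open import Data.Integer using (ℤ; _+_; _*_; _^_)
open import Data.Integer.Properties using (+-identityˡ; +-assoc; *-zeroʳ; *-distribˡ-+; *-distribʳ-+)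
open import Data.Fin.Subset using (Subset; _⊆_; _∩_; ⋂; Nonempty)
open import Data.Fin.Subset.Properties using (_⊆?_; ∩-identityʳ; p∩q⊆p; x∈p∩q⁺)
open import Data.List using (List; []; _∷_; _++_; map; concatMap)
open import Data.List.Properties using (map-++; map-∘; map-cong-local)
open import Data.List.Relation.Unary.All using (All; []; _∷_; tabulate)
open import Data.List.Relation.Unary.Any using (here)
open import Data.List.Membership.Propositional using (_∈_; find)
open import Data.List.Membership.Propositional.Properties using (∈-map⁻; ∈-concatMap⁻; ∈-filter⁺; ∈-filter⁻)
open import Data.Product using (_×_; _,_; ∃₂; proj₁; proj₂)
open import Function using (_∘_)
open import Relation.Binary.PropositionalEquality using (_≡_; refl; sym; trans; cong; cong₂; subst; module ≡-Reasoning)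
open import Relation.Nullary using (yes; no; contradiction)

sumℤ-++ : (xs ys : List ℤ) → sumℤ (xs ++ ys) ≡ sumℤ xs + sumℤ ys
sumℤ-++ []       ys = sym (+-identityˡ (sumℤ ys))
sumℤ-++ (x ∷ xs) ys = trans (cong (x +_) (sumℤ-++ xs ys)) (sym (+-assoc x (sumℤ xs) (sumℤ ys)))

sumℤ-*ˡ : (c : ℤ) (xs : List ℤ) → sumℤ (map (c *_) xs) ≡ c * sumℤ xs
sumℤ-*ˡ c []       = sym (*-zeroʳ c)
sumℤ-*ˡ c (x ∷ xs) = trans (cong (c * x +_) (sumℤ-*ˡ c xs)) (sym (*-distribˡ-+ c x (sumℤ xs)))

module _ {X : Set} (f : X → ℤ) where

  private
    Πf : List X → ℤ
    Πf = productℤ ∘ map f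

  sum-product-prepend : (a : X) (T : List (List X)) →
    sumℤ (map Πf (map (a ∷_) T)) ≡ f a * sumℤ (map Πf T)
  -- Πf ∘ (a ∷_) and (f a *_) ∘ Πf are definitionally equal.
  sum-product-prepend a T = trans (cong sumℤ (trans (sym (map-∘ T)) (map-∘ T))) (sumℤ-*ˡ (f a) (map Πf T))

  sum-product-extend : (A : List X) (T : List (List X)) →
    sumℤ (map Πf (concatMap (λ a → map (a ∷_) T) A)) ≡ sumℤ (map f A) * sumℤ (map Πf T)
  sum-product-extend []      T = refl
  sum-product-extend (a ∷ A) T = begin
    sumℤ (map Πf (map (a ∷_) T ++ rest))
      ≡⟨ cong sumℤ (map-++ Πf (map (a ∷_) T) rest) ⟩
    sumℤ (map Πf (map (a ∷_) T) ++ map Πf rest)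
      ≡⟨ sumℤ-++ (map Πf (map (a ∷_) T)) (map Πf rest) ⟩
    sumℤ (map Πf (map (a ∷_) T)) + sumℤ (map Πf rest)
      ≡⟨ cong₂ _+_ (sum-product-prepend a T) (sum-product-extend A T) ⟩
    f a * sumℤ (map Πf T) + sumℤ (map f A) * sumℤ (map Πf T)
      ≡⟨ sym (*-distribʳ-+ (sumℤ (map Πf T)) (f a) (sumℤ (map f A))) ⟩
    (f a + sumℤ (map f A)) * sumℤ (map Πf T) ∎
    where
    open ≡-Reasoning
    rest = concatMap (λ a → map (a ∷_) T) A

  sum-product-tuples : (k : ℕ) (A : List X) → sumℤ (map Πf (tuples k A)) ≡ sumℤ (map f A) ^ k
  sum-product-tuples zero  A = refl
  sum-product-tuples (suc k) A =
    trans (sum-product-extend A (tuples k A)) (cong (sumℤ (map f A) *_) (sum-product-tuples k A))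

module _ {X : Set} {A : List X} where

  ∈-tuples-suc⁻ : ∀ {k ys} → ys ∈ tuples (suc k) A →
    ∃₂ λ a zs → ys ≡ a ∷ zs × a ∈ A × zs ∈ tuples k A
  ∈-tuples-suc⁻ {k} ys∈ with find (∈-concatMap⁻ (λ a → map (a ∷_) (tuples k A)) {xs = A} ys∈)
  ... | a , a∈A , ys∈a∷T with ∈-map⁻ (a ∷_) ys∈a∷T
  ...   | zs , zs∈T , ys≡a∷zs = a , zs , ys≡a∷zs , a∈A , zs∈T

  ∈-tuples⁻ : ∀ {k ys} → ys ∈ tuples k A → All (_∈ A) ys
  ∈-tuples⁻ {zero} (here refl) = []
  ∈-tuples⁻ {suc k}  ys∈ with ∈-tuples-suc⁻ {k} ys∈
  ... | _ , _ , refl , a∈A , zs∈ = a∈A ∷ ∈-tuples⁻ {k} zs∈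

module _ {n : ℕ} {A : List (Subset n)} where

  ∩-Closed : Set
  ∩-Closed = ∀ {a b} → a ∈ A → b ∈ A → a ∩ b ∈ A

  ⋂-∈-∩-closed : ∩-Closed → ∀ {a ys} → a ∈ A → All (_∈ A) ys → ⋂ (a ∷ ys) ∈ A
  ⋂-∈-∩-closed meet {a} a∈A []          = subst (_∈ A) (sym (∩-identityʳ a)) a∈A
  ⋂-∈-∩-closed meet     a∈A (b∈A ∷ bs) = meet a∈A (⋂-∈-∩-closed meet b∈A bs)

  ⋂-tuples-∈-∩-closed : ∩-Closed → ∀ {k ys} → ys ∈ tuples (suc k) A → ⋂ ys ∈ A
  ⋂-tuples-∈-∩-closed meet {k} ys∈ with ∈-tuples-suc⁻ {A = A} {k = k} ys∈
  ... | _ , _ , refl , a∈A , zs∈ = ⋂-∈-∩-closed meet a∈A (∈-tuples⁻ {A = A} {k = k} zs∈)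

  contrib-≡-product : ∀ {ys} → ⋂ ys ∈ A → contrib A ys ≡ productℤ (map ω ys)
  contrib-≡-product {ys} ⋂ys∈A with ⋂ ys ∈? A
  ... | yes _ = refl
  ... | no ⋂ys∉A = contradiction ⋂ys∈A ⋂ys∉A

  w-∩-closed : ∩-Closed → ∀ m → w (suc m) A ≡ χ A ^ suc m
  w-∩-closed meet m = trans
    (cong sumℤ (map-cong-local (tabulate (contrib-≡-product ∘ ⋂-tuples-∈-∩-closed meet {m}))))
    (sum-product-tuples ω (suc m) A)

U-∩-closed : ∀ {n} (G : Complex n) {x : Subset n} → Nonempty x → ∩-Closed {A = U G x}
U-∩-closed G {x} (i , i∈x) {a} {b} a∈U b∈U = ∈-filter⁺ (x ⊆?_) a∩b∈G x⊆a∩b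
  where
  a∈G×x⊆a : a ∈ faces G × x ⊆ a
  a∈G×x⊆a = ∈-filter⁻ (x ⊆?_) {xs = faces G} a∈U
  b∈G×x⊆b : b ∈ faces G × x ⊆ b
  b∈G×x⊆b = ∈-filter⁻ (x ⊆?_) {xs = faces G} b∈U

  x⊆a∩b : x ⊆ a ∩ b
  x⊆a∩b j∈x = x∈p∩q⁺ (proj₂ a∈G×x⊆a j∈x , proj₂ b∈G×x⊆b j∈x)

  a∩b∈G : a ∩ b ∈ faces G
  a∩b∈G = closed G (proj₁ a∈G×x⊆a) (i , x⊆a∩b i∈x) (p∩q⊆p a b)

mainTheorem10 : ∀ {n : ℕ} (G : Complex n) (x : Subset n) → x ∈ faces G →
    ∀ (m : ℕ) → w (suc m) (U G x) ≡ χ (U G x) ^ suc m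
mainTheorem10 G x x∈G = w-∩-closed (U-∩-closed G (nonempty G x∈G))
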